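{- Let $R_1$ and $R_2$ be finite commutative principal ideal rings with unity, and let $R=R_1\times R_2$, where $\mathrm{diam}(\Gamma(R_1))=\mathrm{diam}(\Gamma(R_2))=0$. Then $\overline{\Gamma(R)}$ is a divisor graph if and only if at least one of $R_1$ and $R_2$ is an integral domain.
   Context: For a commutative ring $S$ with unity, $Z(S)$ is its set of zero divisors. The zero divisor graph $\Gamma(S)$ has vertex set $Z(S)\setminus\{0\}$, distinct $a,b$ adjacent iff $ab=0$; its complement $\overline{\Gamma(S)}$ has the same vertex set, distinct $a,b$ adjacent iff $ab\neq0$. The diameter $\mathrm{diam}$ of a graph is the maximum distance between two of its vertices; a graph with one vertex has diameter $0$, and (as in the paper) the empty zero divisor graph of an integral domain is also regarded as having diameter $0$. A graph $G$ is a divisor graph if it is isomorphic to the graph $G(S)$ on some set $S$ of positive integers in which distinct $i,j$ are adjacent iff $i\mid j$ or $j\mid i$. -}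

module Defs where

open import Level using (Level; _⊔_)
import Level
open import Algebra.Bundles using (CommutativeRing)
open import Data.Nat using (ℕ; zero; suc; _≤_)
open import Data.Nat.Divisibility using (_∣_)
open import Data.Fin using (Fin)
open import Data.Product using (Σ; ∃; _×_; _,_; proj₁)
open import Data.Sum using (_⊎_)
open import Relation.Nullary using (¬_)
open import Relation.Binary.PropositionalEquality using (_≡_)
import Relation.Binary.PropositionalEquality as ≡
open import Function.Bundles using (Inverse; _⇔_)

module _ {v ℓ a : Level} {V : Set v} (_≈_ : V → V → Set ℓ) (Adj : V → V → Set a) where

  data Walk : V → V → ℕ → Set (v ⊔ ℓ ⊔ a) where
    here : ∀ {x y} → x ≈ y → Walk x y zero
    step : ∀ {x w y n} → Adj x w → Walk w y n → Walk x y (suc n)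

  DiamAtMost : ℕ → Set (v ⊔ ℓ ⊔ a)
  DiamAtMost d = ∀ x y → ∃ λ n → n ≤ d × Walk x y n

  -- diam(G) = 0  (diameter is always ≥ 0, so this is diam ≤ 0;
  -- the empty graph satisfies it vacuously, as in the paper)
  DiamZero : Set (v ⊔ ℓ ⊔ a)
  DiamZero = DiamAtMost zero

  -- G is a divisor graph: G ≅ G(S) for a set S of positive integers,
  -- given by an injective labelling f (S = image of f) under which
  -- distinct x,y are adjacent iff f x ∣ f y or f y ∣ f x.
  IsDivisorGraph : Set (v ⊔ ℓ ⊔ a)
  IsDivisorGraph =
    Σ (V → ℕ) λ f →
      (∀ x → 1 ≤ f x) ×
      (∀ x y → x ≈ y → f x ≡ f y) ×
      (∀ x y → f x ≡ f y → x ≈ y) ×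
      (∀ x y → ¬ (x ≈ y) → (Adj x y ⇔ (f x ∣ f y ⊎ f y ∣ f x)))

module _ {c ℓ : Level} (R : CommutativeRing c ℓ) where
  open CommutativeRing R

  Finite : Set (c ⊔ ℓ)
  Finite = ∃ λ n → Inverse setoid (≡.setoid (Fin n))

  record IsIdeal (I : Carrier → Set (c ⊔ ℓ)) : Set (c ⊔ ℓ) where
    field
      resp  : ∀ {x y} → x ≈ y → I x → I y
      has0  : I 0#
      +-closed : ∀ {x y} → I x → I y → I (x + y)
      *-closed : ∀ r {x} → I x → I (r * x)

  IsPrincipalIdealRing : Set (Level.suc (c ⊔ ℓ))
  IsPrincipalIdealRing =
    ∀ (I : Carrier → Set (c ⊔ ℓ)) → IsIdeal I →
      ∃ λ g → ∀ x → (I x ⇔ (∃ λ r → x ≈ r * g))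

  IsIntegralDomain : Set (c ⊔ ℓ)
  IsIntegralDomain =
    ¬ (1# ≈ 0#) × (∀ x y → x * y ≈ 0# → x ≈ 0# ⊎ y ≈ 0#)

  IsZeroDivisor : Carrier → Set (c ⊔ ℓ)
  IsZeroDivisor x = ∃ λ y → ¬ (y ≈ 0#) × x * y ≈ 0#

  Vertex : Set (c ⊔ ℓ)
  Vertex = Σ Carrier λ x → IsZeroDivisor x × ¬ (x ≈ 0#)

  _≈ᵥ_ : Vertex → Vertex → Set ℓ
  x ≈ᵥ y = proj₁ x ≈ proj₁ y

  AdjΓ : Vertex → Vertex → Set ℓ
  AdjΓ x y = ¬ (x ≈ᵥ y) × (proj₁ x * proj₁ y ≈ 0#)

  AdjΓc : Vertex → Vertex → Set ℓ
  AdjΓc x y = ¬ (x ≈ᵥ y) × ¬ (proj₁ x * proj₁ y ≈ 0#)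

  DiamΓZero : Set (c ⊔ ℓ)
  DiamΓZero = DiamZero _≈ᵥ_ AdjΓ

  ComplementΓIsDivisorGraph : Set (c ⊔ ℓ)
  ComplementΓIsDivisorGraph = IsDivisorGraph _≈ᵥ_ AdjΓc

-- If Γ(Rᵢ) has diameter 0 and Rᵢ is not a domain, then Rᵢ has a nonzero element a with a² = 0.
-- When both factors have one, the seven elements (p , q) with p, q ∈ {0, 1, a} that are nonzero
-- zero divisors induce a subgraph of the complement of Γ(R₁ × R₂) admitting no transitive
-- orientation, whereas divisibility orients every divisor graph transitively.
-- Conversely, if R₁ is a domain the vertices are (0 , y) with y ≠ 0, and (x , y) with x ≠ 0 and
-- y = 0 or y the unique nonzero zero divisor of R₂. Labelling them by points of ℕ × ℕ so that
-- adjacency becomes comparability in the product order, and then the point (i , j) by 2ⁱ3ʲ,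
-- exhibits the complement as a divisor graph.
module Submission where

open import Defs
open import Level using (Level; _⊔_)
open import Algebra.Bundles using (CommutativeRing)
open import Algebra.Construct.DirectProduct using (commutativeRing)
open import Data.Sum using (_⊎_)
open import Relation.Nullary using (¬_)
open import Function.Bundles using (_⇔_)

open import Data.Empty using (⊥; ⊥-elim)
open import Data.Fin using (toℕ)
open import Data.Fin.Properties as Fin using (toℕ<n; toℕ-injective; _≟_)
open import Data.Nat using (ℕ; zero; suc; _+_; _≤_; _<_; z≤n; s≤s)
open import Data.Nat.Divisibility using (_∣_; ∣-trans)
open import Data.Nat.Properties
  using (≤-refl; ≤-total; ≤-trans; ≤-reflexive; <⇒≤; <⇒≢; <⇒≱; 1+n≰n; m≤m+n; suc-injective; +-cancelˡ-≡)
open import Data.Product as × using (Σ; ∃; _×_; _,_; proj₁; proj₂; swap)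
open import Data.Product.Relation.Binary.Pointwise.NonDependent using (Pointwise)
open import Data.Sum as ⊎ using (inj₁; inj₂)
open import Data.Sum.Function.Propositional using (_⊎-⇔_)
open import Function.Base using (_∘_; flip)
open import Function.Bundles using (Equivalence; Inverse; mk⇔)
open import Function.Construct.Composition using (_⇔-∘_)
open import Function.Construct.Symmetry using (⇔-sym)
open import Relation.Binary.Definitions using (Transitive; _Respects_)
open import Relation.Binary.PropositionalEquality as ≡ using (_≡_; _≢_; refl; cong; cong₂)
open import Relation.Nullary using (Dec; yes; no; ¬?; contradiction)
open import Relation.Nullary.Decidable using (map′; _×-dec_)
open import Relation.Unary using (Pred; Decidable)

Comparable : ∀ {a r} {A : Set a} → (A → A → Set r) → A → A → Set r
Comparable _⊑_ x y = x ⊑ y ⊎ y ⊑ x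

_≤²_ : ℕ × ℕ → ℕ × ℕ → Set
_≤²_ = Pointwise _≤_ _≤_

comparable-fst : ∀ a b c → Comparable _≤²_ (a , c) (b , c)
comparable-fst a b c with ≤-total a b
... | inj₁ a≤b = inj₁ (a≤b , ≤-refl)
... | inj₂ b≤a = inj₂ (b≤a , ≤-refl)

comparable-snd : ∀ a b c → Comparable _≤²_ (c , a) (c , b)
comparable-snd a b c with ≤-total a b
... | inj₁ a≤b = inj₁ (≤-refl , a≤b)
... | inj₂ b≤a = inj₂ (≤-refl , b≤a)

module _ where
  open import Data.Nat using (_*_; _^_; NonZero)
  open import Data.Nat.Divisibility using (1∣_; ∣1⇒≡1; ∣-reflexive; _∣?_; m∣m*n; n∣m*n; *-pres-∣; *-monoʳ-∣; *-cancelˡ-∣)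
  open import Data.Nat.Primality using (Prime; prime?; prime[2]; ¬prime[1]; prime⇒nonZero; euclidsLemma)
  open import Data.Nat.Properties using (_≤?_; ≰⇒>; ≤-antisym; *-comm; *-mono-≤; m^n>0; m^n≢0)
  open import Relation.Nullary.Decidable using (toWitness; toWitnessFalse)

  ^-monoʳ-∣ : ∀ m {a c} → a ≤ c → m ^ a ∣ m ^ c
  ^-monoʳ-∣ m {c = c} z≤n       = 1∣ (m ^ c)
  ^-monoʳ-∣ m         (s≤s a≤c) = *-monoʳ-∣ m (^-monoʳ-∣ m a≤c)

  prime∤⇒∤^ : ∀ {p q} → Prime p → ¬ p ∣ q → ∀ d → ¬ p ∣ q ^ d
  prime∤⇒∤^ p-prime p∤q zero    p∣1 = ¬prime[1] (≡.subst Prime (∣1⇒≡1 p∣1) p-prime)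
  prime∤⇒∤^ p-prime p∤q (suc d) p∣q*q^d with euclidsLemma _ _ p-prime p∣q*q^d
  ... | inj₁ p∣q   = p∤q p∣q
  ... | inj₂ p∣q^d = prime∤⇒∤^ p-prime p∤q d p∣q^d

  prime^∣prime^*∤⇒≤ : ∀ {p m a c} → Prime p → ¬ p ∣ m → p ^ a ∣ p ^ c * m → a ≤ c
  prime^∣prime^*∤⇒≤ {p} {m} {a} {c} p-prime p∤m p^a∣p^c*m with a ≤? c
  ... | yes a≤c = a≤c
  ... | no  a≰c = contradiction (*-cancelˡ-∣ (p ^ c) {{p^c≢0}} p^c*p∣p^c*m) p∤m
    where
    p^c≢0 : NonZero (p ^ c)
    p^c≢0 = m^n≢0 p c {{prime⇒nonZero p-prime}}

    p^c*p∣p^c*m : p ^ c * p ∣ p ^ c * m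
    p^c*p∣p^c*m = ≡.subst (_∣ p ^ c * m) (*-comm p (p ^ c)) (∣-trans (^-monoʳ-∣ p (≰⇒> a≰c)) p^a∣p^c*m)

  2^*3^ : ℕ × ℕ → ℕ
  2^*3^ (a , b) = 2 ^ a * 3 ^ b

  2^*3^-positive : ∀ p → 1 ≤ 2^*3^ p
  2^*3^-positive (a , b) = *-mono-≤ (m^n>0 2 a) (m^n>0 3 b)

  2^*3^-∣⇔≤² : ∀ p q → 2^*3^ p ∣ 2^*3^ q ⇔ p ≤² q
  2^*3^-∣⇔≤² (a , b) (c , d) = mk⇔ ∣⇒≤² (λ (a≤c , b≤d) → *-pres-∣ (^-monoʳ-∣ 2 a≤c) (^-monoʳ-∣ 3 b≤d))
    where
    prime[3] : Prime 3
    prime[3] = toWitness {a? = prime? 3} _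

    ∣⇒≤² : 2 ^ a * 3 ^ b ∣ 2 ^ c * 3 ^ d → a ≤ c × b ≤ d
    ∣⇒≤² ∣ = prime^∣prime^*∤⇒≤ prime[2] (prime∤⇒∤^ prime[2] (toWitnessFalse {a? = 2 ∣? 3} _) d)
                (∣-trans (m∣m*n (3 ^ b)) ∣)
           , prime^∣prime^*∤⇒≤ prime[3] (prime∤⇒∤^ prime[3] (toWitnessFalse {a? = 3 ∣? 2} _) c)
                (≡.subst (3 ^ b ∣_) (*-comm (2 ^ c) (3 ^ d)) (∣-trans (n∣m*n (2 ^ a)) ∣))

  2^*3^-injective : ∀ p q → 2^*3^ p ≡ 2^*3^ q → p ≡ q
  2^*3^-injective p q e with Equivalence.to (2^*3^-∣⇔≤² p q) (∣-reflexive e)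
                           | Equivalence.to (2^*3^-∣⇔≤² q p) (∣-reflexive (≡.sym e))
  ... | a≤c , b≤d | c≤a , d≤b = cong₂ _,_ (≤-antisym a≤c c≤a) (≤-antisym b≤d d≤b)

module _ {v ℓ a} {V : Set v} {_≈_ : V → V → Set ℓ} {Adj : V → V → Set a} where

  DiamZero⇒≈ : DiamZero _≈_ Adj → ∀ x y → x ≈ y
  DiamZero⇒≈ diam x y with diam x y
  ... | zero , _ , here x≈y = x≈y

  comparabilityLabelling⇒IsDivisorGraph : (g : V → ℕ × ℕ) →
    (∀ {x y} → x ≈ y → g x ≡ g y) → (∀ {x y} → g x ≡ g y → x ≈ y) →
    (∀ {x y} → ¬ x ≈ y → Adj x y ⇔ Comparable _≤²_ (g x) (g y)) →
    IsDivisorGraph _≈_ Adj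
  comparabilityLabelling⇒IsDivisorGraph g g-cong g-injective g-adj =
    2^*3^ ∘ g , 2^*3^-positive ∘ g ,
    (λ x y → cong 2^*3^ ∘ g-cong) , (λ x y → g-injective ∘ 2^*3^-injective _ _) ,
    λ x y x≉y → ⇔-sym (2^*3^-∣⇔≤² (g x) (g y) ⊎-⇔ 2^*3^-∣⇔≤² (g y) (g x)) ⇔-∘ g-adj x≉y

module _ {v w ℓ ℓ′ a b} {V : Set v} {W : Set w}
         {_≈_ : V → V → Set ℓ} {_≈′_ : W → W → Set ℓ′}
         {Adj : V → V → Set a} {Adj′ : W → W → Set b} where

  IsDivisorGraph-induced : (φ : V → W) →
    (∀ {x y} → x ≈ y → φ x ≈′ φ y) → (∀ {x y} → φ x ≈′ φ y → x ≈ y) →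
    (∀ {x y} → ¬ x ≈ y → Adj x y ⇔ Adj′ (φ x) (φ y)) →
    IsDivisorGraph _≈′_ Adj′ → IsDivisorGraph _≈_ Adj
  IsDivisorGraph-induced φ φ-cong φ-reflect φ-adj (f , f-positive , f-cong , f-injective , f-adj) =
    f ∘ φ , f-positive ∘ φ , (λ x y → f-cong _ _ ∘ φ-cong) , (λ x y → φ-reflect ∘ f-injective _ _) ,
    λ x y x≉y → f-adj _ _ (x≉y ∘ φ-reflect) ⇔-∘ φ-adj x≉y

-- The multiplicative monoid {0, 1, ε} with ε² = 0, modelling 0, 1 and a nonzero square-zero element.
data Code : Set where
  𝟘 𝟙 ε : Code

infixl 7 _·_ _·²_

_·_ : Code → Code → Code
𝟘 · _ = 𝟘
𝟙 · q = q
ε · 𝟘 = 𝟘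
ε · 𝟙 = ε
ε · ε = 𝟘

·-comm : ∀ p q → p · q ≡ q · p
·-comm 𝟘 𝟘 = refl
·-comm 𝟘 𝟙 = refl
·-comm 𝟘 ε = refl
·-comm 𝟙 𝟘 = refl
·-comm 𝟙 𝟙 = refl
·-comm 𝟙 ε = refl
·-comm ε 𝟘 = refl
·-comm ε 𝟙 = refl
·-comm ε ε = refl

Code² : Set
Code² = Code × Code

𝟘² : Code²
𝟘² = 𝟘 , 𝟘

_·²_ : Code² → Code² → Code²
(p , q) ·² (p′ , q′) = p · p′ , q · q′

·²-comm : ∀ c d → c ·² d ≡ d ·² c
·²-comm (p , q) (p′ , q′) = cong₂ _,_ (·-comm p p′) (·-comm q q′)

data ZeroDivisorCode : Set where
  𝟘𝟙 𝟘ε 𝟙𝟘 𝟙ε ε𝟘 ε𝟙 εε : ZeroDivisorCode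

code : ZeroDivisorCode → Code²
code 𝟘𝟙 = 𝟘 , 𝟙
code 𝟘ε = 𝟘 , ε
code 𝟙𝟘 = 𝟙 , 𝟘
code 𝟙ε = 𝟙 , ε
code ε𝟘 = ε , 𝟘
code ε𝟙 = ε , 𝟙
code εε = ε , ε

code-nonzero : ∀ u → code u ≢ 𝟘²
code-nonzero 𝟘𝟙 ()
code-nonzero 𝟘ε ()
code-nonzero 𝟙𝟘 ()
code-nonzero 𝟙ε ()
code-nonzero ε𝟘 ()
code-nonzero ε𝟙 ()
code-nonzero εε ()

code-zeroDivisor : ∀ u → ∃ λ w → w ≢ 𝟘² × code u ·² w ≡ 𝟘²
code-zeroDivisor 𝟘𝟙 = (ε , 𝟘) , (λ ()) , refl
code-zeroDivisor 𝟘ε = (ε , 𝟘) , (λ ()) , refl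
code-zeroDivisor 𝟙𝟘 = (𝟘 , ε) , (λ ()) , refl
code-zeroDivisor 𝟙ε = (𝟘 , ε) , (λ ()) , refl
code-zeroDivisor ε𝟘 = (ε , 𝟘) , (λ ()) , refl
code-zeroDivisor ε𝟙 = (ε , 𝟘) , (λ ()) , refl
code-zeroDivisor εε = (ε , 𝟘) , (λ ()) , refl

_≈ᶜ_ : ZeroDivisorCode → ZeroDivisorCode → Set
u ≈ᶜ v = code u ≡ code v

Meets : ZeroDivisorCode → ZeroDivisorCode → Set
Meets u v = code u ·² code v ≢ 𝟘²

Meets-sym : ∀ {u v} → Meets u v → Meets v u
Meets-sym {u} {v} meets vu≡𝟘² = meets (≡.trans (·²-comm (code u) (code v)) vu≡𝟘²)

private
  module Forcing {r} {_⊑_ : ZeroDivisorCode → ZeroDivisorCode → Set r} (⊑-trans : Transitive _⊑_)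
    (adjacent : ∀ {u v} → ¬ u ≈ᶜ v → Meets u v → Comparable _⊑_ u v)
    (nonadjacent : ∀ {u v} → ¬ u ≈ᶜ v → ¬ Meets u v → ¬ u ⊑ v) where

    annihilate : ∀ {u v} → ¬ u ≈ᶜ v → code u ·² code v ≡ 𝟘² → ¬ u ⊑ v
    annihilate u≉v uv≡𝟘² = nonadjacent u≉v (λ meets → meets uv≡𝟘²)

    ⊑-above : ∀ {x y z} → x ⊑ y → Comparable _⊑_ y z → ¬ x ⊑ z → z ⊑ y
    ⊑-above x⊑y (inj₁ y⊑z) x⋢z = contradiction (⊑-trans x⊑y y⊑z) x⋢z
    ⊑-above x⊑y (inj₂ z⊑y) x⋢z = z⊑y

    ⊑-below : ∀ {x y z} → x ⊑ y → Comparable _⊑_ x z → ¬ z ⊑ y → x ⊑ z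
    ⊑-below x⊑y (inj₁ x⊑z) z⋢y = x⊑z
    ⊑-below x⊑y (inj₂ z⊑x) z⋢y = contradiction (⊑-trans z⊑x x⊑y) z⋢y

    -- Orienting 𝟘𝟙 → 𝟘ε forces, one edge at a time, 𝟙𝟘 ⊑ ε𝟙 ⊑ 𝟘ε across the non-edge 𝟙𝟘 – 𝟘ε.
    𝟘𝟙⋢𝟘ε : ¬ 𝟘𝟙 ⊑ 𝟘ε
    𝟘𝟙⋢𝟘ε 𝟘𝟙⊑𝟘ε = annihilate (λ ()) refl (⊑-trans 𝟙𝟘⊑ε𝟙 ε𝟙⊑𝟘ε)
      where
      𝟘𝟙⊑𝟙ε : 𝟘𝟙 ⊑ 𝟙ε
      𝟘𝟙⊑𝟙ε = ⊑-below 𝟘𝟙⊑𝟘ε (adjacent (λ ()) (λ ())) (annihilate (λ ()) refl)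
      𝟘𝟙⊑εε : 𝟘𝟙 ⊑ εε
      𝟘𝟙⊑εε = ⊑-below 𝟘𝟙⊑𝟘ε (adjacent (λ ()) (λ ())) (annihilate (λ ()) refl)
      ε𝟘⊑𝟙ε : ε𝟘 ⊑ 𝟙ε
      ε𝟘⊑𝟙ε = ⊑-above 𝟘𝟙⊑𝟙ε (adjacent (λ ()) (λ ())) (annihilate (λ ()) refl)
      𝟙𝟘⊑εε : 𝟙𝟘 ⊑ εε
      𝟙𝟘⊑εε = ⊑-above 𝟘𝟙⊑εε (adjacent (λ ()) (λ ())) (annihilate (λ ()) refl)
      ε𝟙⊑𝟙ε : ε𝟙 ⊑ 𝟙ε
      ε𝟙⊑𝟙ε = ⊑-above ε𝟘⊑𝟙ε (adjacent (λ ()) (λ ())) (annihilate (λ ()) refl)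
      𝟙𝟘⊑ε𝟘 : 𝟙𝟘 ⊑ ε𝟘
      𝟙𝟘⊑ε𝟘 = ⊑-below 𝟙𝟘⊑εε (adjacent (λ ()) (λ ())) (annihilate (λ ()) refl)
      ε𝟙⊑𝟘ε : ε𝟙 ⊑ 𝟘ε
      ε𝟙⊑𝟘ε = ⊑-below ε𝟙⊑𝟙ε (adjacent (λ ()) (λ ())) (annihilate (λ ()) refl)
      𝟙𝟘⊑ε𝟙 : 𝟙𝟘 ⊑ ε𝟙
      𝟙𝟘⊑ε𝟙 = ⊑-below 𝟙𝟘⊑ε𝟘 (adjacent (λ ()) (λ ())) (annihilate (λ ()) refl)

Meets-notComparabilityGraph : ∀ {r} {_⊑_ : ZeroDivisorCode → ZeroDivisorCode → Set r} → Transitive _⊑_ →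
  (∀ {u v} → ¬ u ≈ᶜ v → Meets u v → Comparable _⊑_ u v) →
  (∀ {u v} → ¬ u ≈ᶜ v → ¬ Meets u v → ¬ u ⊑ v) → ⊥
Meets-notComparabilityGraph ⊑-trans adjacent nonadjacent with adjacent {𝟘𝟙} {𝟘ε} (λ ()) (λ ())
... | inj₁ 𝟘𝟙⊑𝟘ε = Forcing.𝟘𝟙⋢𝟘ε ⊑-trans adjacent nonadjacent 𝟘𝟙⊑𝟘ε
... | inj₂ 𝟘ε⊑𝟘𝟙 = Forcing.𝟘𝟙⋢𝟘ε (flip ⊑-trans) (λ u≉v → ⊎.swap ∘ adjacent u≉v)
  (λ {u} {v} u≉v ¬meets → nonadjacent (u≉v ∘ ≡.sym) (¬meets ∘ Meets-sym {v} {u})) 𝟘ε⊑𝟘𝟙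

Meets-notDivisorGraph : ¬ IsDivisorGraph _≈ᶜ_ Meets
Meets-notDivisorGraph (f , _ , _ , _ , f-adj) = Meets-notComparabilityGraph ∣-trans
  (λ u≉v → Equivalence.to (f-adj _ _ u≉v))
  (λ u≉v ¬meets fu∣fv → ¬meets (Equivalence.from (f-adj _ _ u≉v) (inj₁ fu∣fv)))

module _ {c ℓ} (R : CommutativeRing c ℓ) where
  open CommutativeRing R

  Nontrivial : Set ℓ
  Nontrivial = ¬ 1# ≈ 0#

  IsVertex : Carrier → Set (c ⊔ ℓ)
  IsVertex x = IsZeroDivisor R x × ¬ x ≈ 0#

  SquareZeroElement : Set (c ⊔ ℓ)
  SquareZeroElement = ∃ λ a → ¬ a ≈ 0# × a * a ≈ 0#

  x≈0⇒x*y≈0 : ∀ {x} y → x ≈ 0# → x * y ≈ 0#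
  x≈0⇒x*y≈0 y x≈0 = trans (*-congʳ x≈0) (zeroˡ y)

  y≈0⇒x*y≈0 : ∀ x {y} → y ≈ 0# → x * y ≈ 0#
  y≈0⇒x*y≈0 x y≈0 = trans (*-congˡ y≈0) (zeroʳ x)

  IsZeroDivisor-resp : IsZeroDivisor R Respects _≈_
  IsZeroDivisor-resp x≈y (t , t≉0 , xt≈0) = t , t≉0 , trans (*-congʳ (sym x≈y)) xt≈0

  AdjΓc⇔*≉0 : ∀ {v w} → ¬ _≈ᵥ_ R v w → AdjΓc R v w ⇔ (¬ proj₁ v * proj₁ w ≈ 0#)
  AdjΓc⇔*≉0 v≉w = mk⇔ proj₂ (v≉w ,_)

  annihilatingVertex : (v : Vertex R) → Σ (Vertex R) λ w → proj₁ v * proj₁ w ≈ 0#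
  annihilatingVertex (x , (t , t≉0 , xt≈0) , x≉0) = (t , (x , x≉0 , trans (*-comm t x) xt≈0) , t≉0) , xt≈0

  diamΓZero⇒*≈0 : DiamΓZero R → (v w : Vertex R) → proj₁ v * proj₁ w ≈ 0#
  diamΓZero⇒*≈0 diam v w with annihilatingVertex v
  ... | t , vt≈0 = trans (*-congˡ (DiamZero⇒≈ diam w t)) vt≈0

  diamΓZero⇒squareZeroElement : DiamΓZero R → Vertex R → SquareZeroElement
  diamΓZero⇒squareZeroElement diam v@(x , _ , x≉0) = x , x≉0 , diamΓZero⇒*≈0 diam v v

module FiniteRing {c ℓ} (R : CommutativeRing c ℓ) (finite : Finite R) where
  open CommutativeRing R hiding (refl)
  open Inverse (proj₂ finite) using (to; from; to-cong; strictlyInverseʳ)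

  index : Carrier → ℕ
  index = toℕ ∘ to

  index< : ∀ x → index x < proj₁ finite
  index< = toℕ<n ∘ to

  index-cong : ∀ {x y} → x ≈ y → index x ≡ index y
  index-cong = cong toℕ ∘ to-cong

  to-injective : ∀ {x y} → to x ≡ to y → x ≈ y
  to-injective {x} {y} e = trans (sym (strictlyInverseʳ x)) (trans (reflexive (cong from e)) (strictlyInverseʳ y))

  index-injective : ∀ {x y} → index x ≡ index y → x ≈ y
  index-injective = to-injective ∘ toℕ-injective

  infix 4 _≈?_
  _≈?_ : ∀ x y → Dec (x ≈ y)
  x ≈? y = map′ to-injective to-cong (to x ≟ to y)

  any? : ∀ {p} {P : Pred Carrier p} → P Respects _≈_ → Decidable P → Dec (∃ P)
  any? P-resp P? = map′ (λ (k , Pk) → from k , Pk) (λ (x , Px) → to x , P-resp (sym (strictlyInverseʳ x)) Px)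
                        (Fin.any? (P? ∘ from))

  isZeroDivisor? : Decidable (IsZeroDivisor R)
  isZeroDivisor? x = any? (λ t≈t′ (t≉0 , xt≈0) → t≉0 ∘ trans t≈t′ , trans (*-congˡ (sym t≈t′)) xt≈0)
                          (λ t → ¬? (t ≈? 0#) ×-dec (x * t ≈? 0#))

  integralDomain⊎vertex : Nontrivial R → IsIntegralDomain R ⊎ Vertex R
  integralDomain⊎vertex 1≉0 with any? (λ x≈y (zd , x≉0) → IsZeroDivisor-resp R x≈y zd , x≉0 ∘ trans x≈y)
                                      (λ x → isZeroDivisor? x ×-dec ¬? (x ≈? 0#))
  ... | yes vertex = inj₂ vertex
  ... | no ¬vertex = inj₁ (1≉0 , noZeroDivisors)
    where
    noZeroDivisors : ∀ x y → x * y ≈ 0# → x ≈ 0# ⊎ y ≈ 0#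
    noZeroDivisors x y xy≈0 with x ≈? 0# | y ≈? 0#
    ... | yes x≈0 | _       = inj₁ x≈0
    ... | no _    | yes y≈0 = inj₂ y≈0
    ... | no x≉0  | no y≉0  = contradiction (x , (y , y≉0 , xy≈0) , x≉0) ¬vertex

module SquareZeroCodes {c ℓ} (R : CommutativeRing c ℓ) (1≉0 : Nontrivial R)
                       (squareZero : SquareZeroElement R) where
  open CommutativeRing R hiding (refl)

  a : Carrier
  a = proj₁ squareZero

  a≉0 : ¬ a ≈ 0#
  a≉0 = proj₁ (proj₂ squareZero)

  a²≈0 : a * a ≈ 0#
  a²≈0 = proj₂ (proj₂ squareZero)

  ⟦_⟧ : Code → Carrier
  ⟦ 𝟘 ⟧ = 0#
  ⟦ 𝟙 ⟧ = 1#
  ⟦ ε ⟧ = a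

  ⟦⟧-homo : ∀ p q → ⟦ p ⟧ * ⟦ q ⟧ ≈ ⟦ p · q ⟧
  ⟦⟧-homo 𝟘 q = zeroˡ ⟦ q ⟧
  ⟦⟧-homo 𝟙 q = *-identityˡ ⟦ q ⟧
  ⟦⟧-homo ε 𝟘 = zeroʳ a
  ⟦⟧-homo ε 𝟙 = *-identityʳ a
  ⟦⟧-homo ε ε = a²≈0

  1≉a : ¬ 1# ≈ a
  1≉a 1≈a = 1≉0 (trans (sym (*-identityˡ 1#)) (trans (*-cong 1≈a 1≈a) a²≈0))

  ⟦⟧-injective : ∀ {p q} → ⟦ p ⟧ ≈ ⟦ q ⟧ → p ≡ q
  ⟦⟧-injective {𝟘} {𝟘} _   = refl
  ⟦⟧-injective {𝟘} {𝟙} 0≈1 = contradiction (sym 0≈1) 1≉0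
  ⟦⟧-injective {𝟘} {ε} 0≈a = contradiction (sym 0≈a) a≉0
  ⟦⟧-injective {𝟙} {𝟘} 1≈0 = contradiction 1≈0 1≉0
  ⟦⟧-injective {𝟙} {𝟙} _   = refl
  ⟦⟧-injective {𝟙} {ε} 1≈a = contradiction 1≈a 1≉a
  ⟦⟧-injective {ε} {𝟘} a≈0 = contradiction a≈0 a≉0
  ⟦⟧-injective {ε} {𝟙} a≈1 = contradiction (sym a≈1) 1≉a
  ⟦⟧-injective {ε} {ε} _   = refl

module _ {c ℓ} (R₁ R₂ : CommutativeRing c ℓ) (1≉0₁ : Nontrivial R₁) (1≉0₂ : Nontrivial R₂)
         (a₁ : SquareZeroElement R₁) (a₂ : SquareZeroElement R₂) where

  private
    module C₁ = SquareZeroCodes R₁ 1≉0₁ a₁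
    module C₂ = SquareZeroCodes R₂ 1≉0₂ a₂
    R : CommutativeRing c ℓ
    R = commutativeRing R₁ R₂

    open CommutativeRing R hiding (refl)

    ⟦_⟧² : Code² → Carrier
    ⟦ p , q ⟧² = C₁.⟦ p ⟧ , C₂.⟦ q ⟧

    ⟦⟧²-injective : ∀ {c d} → ⟦ c ⟧² ≈ ⟦ d ⟧² → c ≡ d
    ⟦⟧²-injective (p≈p′ , q≈q′) = cong₂ _,_ (C₁.⟦⟧-injective p≈p′) (C₂.⟦⟧-injective q≈q′)

    ⟦⟧²-homo : ∀ c d → ⟦ c ⟧² * ⟦ d ⟧² ≈ ⟦ c ·² d ⟧²
    ⟦⟧²-homo (p , q) (p′ , q′) = C₁.⟦⟧-homo p p′ , C₂.⟦⟧-homo q q′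

    ⟦⟧²-*≈ : ∀ c d {e} → c ·² d ≡ e → ⟦ c ⟧² * ⟦ d ⟧² ≈ ⟦ e ⟧²
    ⟦⟧²-*≈ c d cd≡e = trans (⟦⟧²-homo c d) (reflexive (cong ⟦_⟧² cd≡e))

    codeVertex : ZeroDivisorCode → Vertex R
    codeVertex u with code-zeroDivisor u
    ... | w , w≢𝟘² , uw≡𝟘² =
      ⟦ code u ⟧² , (⟦ w ⟧² , w≢𝟘² ∘ ⟦⟧²-injective , ⟦⟧²-*≈ (code u) w uw≡𝟘²) , code-nonzero u ∘ ⟦⟧²-injective

    codeVertex-adj : ∀ {u v} → ¬ u ≈ᶜ v → Meets u v ⇔ AdjΓc R (codeVertex u) (codeVertex v)
    codeVertex-adj {u} {v} u≉v = mk⇔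
      (λ meets → u≉v ∘ ⟦⟧²-injective , meets ∘ ⟦⟧²-injective ∘ trans (sym (⟦⟧²-homo (code u) (code v))))
      (λ (_ , uv≉0) uv≡𝟘² → uv≉0 (⟦⟧²-*≈ (code u) (code v) uv≡𝟘²))

  squareZero⇒¬ComplementΓIsDivisorGraph : ¬ ComplementΓIsDivisorGraph R
  squareZero⇒¬ComplementΓIsDivisorGraph = Meets-notDivisorGraph ∘
    IsDivisorGraph-induced codeVertex (reflexive ∘ cong ⟦_⟧²) ⟦⟧²-injective codeVertex-adj

module IntegralDomain×DiamΓZero {c ℓ} (R₁ R₂ : CommutativeRing c ℓ) (fin₁ : Finite R₁) (fin₂ : Finite R₂)
                                 (domain₁ : IsIntegralDomain R₁) (diam₂ : DiamΓZero R₂) where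

  private
    module A = CommutativeRing R₁
    module B = CommutativeRing R₂
    module F₁ = FiniteRing R₁ fin₁
    module F₂ = FiniteRing R₂ fin₂
    R : CommutativeRing c ℓ
    R = commutativeRing R₁ R₂

    open CommutativeRing R using (_≈_; _*_; 0#)

    N₁ N₂ : ℕ
    N₁ = proj₁ fin₁
    N₂ = proj₁ fin₂

    nonzero*nonzero : ∀ {x x′} → ¬ x A.≈ A.0# → ¬ x′ A.≈ A.0# → ¬ x A.* x′ A.≈ A.0#
    nonzero*nonzero x≉0 x′≉0 xx′≈0 with proj₂ domain₁ _ _ xx′≈0
    ... | inj₁ x≈0  = x≉0 x≈0
    ... | inj₂ x′≈0 = x′≉0 x′≈0

    regular*nonzero : ∀ {y y′} → ¬ IsZeroDivisor R₂ y → ¬ y′ B.≈ B.0# → ¬ y B.* y′ B.≈ B.0#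
    regular*nonzero ¬zd y′≉0 yy′≈0 = ¬zd (_ , y′≉0 , yy′≈0)

    nonzero*regular : ∀ {y y′} → ¬ y B.≈ B.0# → ¬ IsZeroDivisor R₂ y′ → ¬ y B.* y′ B.≈ B.0#
    nonzero*regular {y} {y′} y≉0 ¬zd yy′≈0 = regular*nonzero ¬zd y≉0 (B.trans (B.*-comm y′ y) yy′≈0)

    nilpotent-unique : ∀ {y y′} → IsVertex R₂ y → IsVertex R₂ y′ → y B.≈ y′
    nilpotent-unique vy vy′ = DiamZero⇒≈ diam₂ (_ , vy) (_ , vy′)

    nilpotent*nilpotent : ∀ {y y′} → IsVertex R₂ y → IsVertex R₂ y′ → y B.* y′ B.≈ B.0#
    nilpotent*nilpotent vy vy′ = diamΓZero⇒*≈0 R₂ diam₂ (_ , vy) (_ , vy′)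

    both : ∀ {p q} {P : Set p} {Q : Set q} → P → Q → P ⇔ Q
    both p q = mk⇔ (λ _ → q) (λ _ → p)

    neither : ∀ {p q} {P : Set p} {Q : Set q} → ¬ P → ¬ Q → P ⇔ Q
    neither ¬p ¬q = mk⇔ (⊥-elim ∘ ¬p) (⊥-elim ∘ ¬q)

  data Kind (x : A.Carrier) (y : B.Carrier) : Set (c ⊔ ℓ) where
    zero-regular      : x A.≈ A.0# → ¬ y B.≈ B.0# → ¬ IsZeroDivisor R₂ y → Kind x y
    zero-nilpotent    : x A.≈ A.0# → IsVertex R₂ y → Kind x y
    nonzero-zero      : ¬ x A.≈ A.0# → y B.≈ B.0# → Kind x y
    nonzero-nilpotent : ¬ x A.≈ A.0# → IsVertex R₂ y → Kind x y

  kind : ((xy , _) : Vertex R) → Kind (proj₁ xy) (proj₂ xy)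
  kind ((x , y) , ((s , t) , st≉0 , xs≈0 , yt≈0) , xy≉0)
    with x F₁.≈? A.0# | y F₂.≈? B.0# | F₂.isZeroDivisor? y
  ... | yes x≈0 | yes y≈0 | _       = contradiction (x≈0 , y≈0) xy≉0
  ... | yes x≈0 | no y≉0  | no ¬zd  = zero-regular x≈0 y≉0 ¬zd
  ... | yes x≈0 | no y≉0  | yes zd  = zero-nilpotent x≈0 (zd , y≉0)
  ... | no x≉0  | yes y≈0 | _       = nonzero-zero x≉0 y≈0
  ... | no x≉0  | no y≉0  | yes zd  = nonzero-nilpotent x≉0 (zd , y≉0)
  ... | no x≉0  | no y≉0  | no ¬zd  with proj₂ domain₁ x s xs≈0
  ...   | inj₁ x≈0 = contradiction x≈0 x≉0
  ...   | inj₂ s≈0 = contradiction (t , (λ t≈0 → st≉0 (s≈0 , t≈0)) , yt≈0) ¬zd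

  -- i and j are the indices of x and y, so j < N₂ and i < N₁: the vertices (0 , y) form a chain
  -- along the first axis and the vertices (x , y) with x ≠ 0 a chain along the second, and the only
  -- comparabilities between the two chains are (0 , regular) below (nonzero , nilpotent).
  position : ∀ {x y} → Kind x y → ℕ → ℕ → ℕ × ℕ
  position (zero-regular _ _ _)    i j = suc j , 0
  position (zero-nilpotent _ _)    i j = suc N₂ , 0
  position (nonzero-zero _ _)      i j = 0 , suc i
  position (nonzero-nilpotent _ _) i j = N₂ , suc (N₁ + i)

  position-resp : ∀ {x y x′ y′} → (x , y) ≈ (x′ , y′) → (k : Kind x y) (k′ : Kind x′ y′) →
                  ∀ i j → position k i j ≡ position k′ i j
  position-resp _ (zero-regular _ _ _)    (zero-regular _ _ _)    i j = refl
  position-resp _ (zero-nilpotent _ _)    (zero-nilpotent _ _)    i j = refl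
  position-resp _ (nonzero-zero _ _)      (nonzero-zero _ _)      i j = refl
  position-resp _ (nonzero-nilpotent _ _) (nonzero-nilpotent _ _) i j = refl
  position-resp (_ , y≈y′) (zero-regular _ _ ¬zd) (zero-nilpotent _ (zd′ , _)) i j =
    ⊥-elim (¬zd (IsZeroDivisor-resp R₂ (B.sym y≈y′) zd′))
  position-resp (_ , y≈y′) (zero-nilpotent _ (zd , _)) (zero-regular _ _ ¬zd′) i j =
    ⊥-elim (¬zd′ (IsZeroDivisor-resp R₂ y≈y′ zd))
  position-resp (_ , y≈y′) (nonzero-zero _ y≈0) (nonzero-nilpotent _ (_ , y′≉0)) i j =
    ⊥-elim (y′≉0 (B.trans (B.sym y≈y′) y≈0))
  position-resp (_ , y≈y′) (nonzero-nilpotent _ (_ , y≉0)) (nonzero-zero _ y′≈0) i j =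
    ⊥-elim (y≉0 (B.trans y≈y′ y′≈0))
  position-resp (x≈x′ , _) (zero-regular x≈0 _ _) (nonzero-zero x′≉0 _) i j =
    ⊥-elim (x′≉0 (A.trans (A.sym x≈x′) x≈0))
  position-resp (x≈x′ , _) (zero-regular x≈0 _ _) (nonzero-nilpotent x′≉0 _) i j =
    ⊥-elim (x′≉0 (A.trans (A.sym x≈x′) x≈0))
  position-resp (x≈x′ , _) (zero-nilpotent x≈0 _) (nonzero-zero x′≉0 _) i j =
    ⊥-elim (x′≉0 (A.trans (A.sym x≈x′) x≈0))
  position-resp (x≈x′ , _) (zero-nilpotent x≈0 _) (nonzero-nilpotent x′≉0 _) i j =
    ⊥-elim (x′≉0 (A.trans (A.sym x≈x′) x≈0))
  position-resp (x≈x′ , _) (nonzero-zero x≉0 _)      (zero-regular x′≈0 _ _) i j =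
    ⊥-elim (x≉0 (A.trans x≈x′ x′≈0))
  position-resp (x≈x′ , _) (nonzero-zero x≉0 _)      (zero-nilpotent x′≈0 _) i j =
    ⊥-elim (x≉0 (A.trans x≈x′ x′≈0))
  position-resp (x≈x′ , _) (nonzero-nilpotent x≉0 _) (zero-regular x′≈0 _ _) i j =
    ⊥-elim (x≉0 (A.trans x≈x′ x′≈0))
  position-resp (x≈x′ , _) (nonzero-nilpotent x≉0 _) (zero-nilpotent x′≈0 _) i j =
    ⊥-elim (x≉0 (A.trans x≈x′ x′≈0))

  position-injective : ∀ {x y x′ y′} (k : Kind x y) (k′ : Kind x′ y′) →
    position k (F₁.index x) (F₂.index y) ≡ position k′ (F₁.index x′) (F₂.index y′) → (x , y) ≈ (x′ , y′)
  position-injective (zero-regular x≈0 _ _) (zero-regular x′≈0 _ _) e =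
    A.trans x≈0 (A.sym x′≈0) , F₂.index-injective (suc-injective (cong proj₁ e))
  position-injective {y = y} (zero-regular _ _ _) (zero-nilpotent _ _) e =
    contradiction (suc-injective (cong proj₁ e)) (<⇒≢ (F₂.index< y))
  position-injective {y′ = y′} (zero-nilpotent _ _) (zero-regular _ _ _) e =
    contradiction (≡.sym (suc-injective (cong proj₁ e))) (<⇒≢ (F₂.index< y′))
  position-injective (zero-nilpotent x≈0 vy) (zero-nilpotent x′≈0 vy′) _ =
    A.trans x≈0 (A.sym x′≈0) , nilpotent-unique vy vy′
  position-injective (nonzero-zero _ y≈0) (nonzero-zero _ y′≈0) e =
    F₁.index-injective (suc-injective (cong proj₂ e)) , B.trans y≈0 (B.sym y′≈0)
  position-injective {x = x} {x′ = x′} (nonzero-zero _ _) (nonzero-nilpotent _ _) e = contradiction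
    (≤-trans (m≤m+n N₁ (F₁.index x′)) (≤-reflexive (≡.sym (suc-injective (cong proj₂ e))))) (<⇒≱ (F₁.index< x))
  position-injective {x = x} {x′ = x′} (nonzero-nilpotent _ _) (nonzero-zero _ _) e = contradiction
    (≤-trans (m≤m+n N₁ (F₁.index x)) (≤-reflexive (suc-injective (cong proj₂ e)))) (<⇒≱ (F₁.index< x′))
  position-injective (nonzero-nilpotent _ vy) (nonzero-nilpotent _ vy′) e =
    F₁.index-injective (+-cancelˡ-≡ N₁ _ _ (suc-injective (cong proj₂ e))) , nilpotent-unique vy vy′
  position-injective (zero-regular _ _ _)    (nonzero-zero _ _)      ()
  position-injective (zero-regular _ _ _)    (nonzero-nilpotent _ _) ()
  position-injective (zero-nilpotent _ _)    (nonzero-zero _ _)      ()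
  position-injective (zero-nilpotent _ _)    (nonzero-nilpotent _ _) ()
  position-injective (nonzero-zero _ _)      (zero-regular _ _ _)    ()
  position-injective (nonzero-zero _ _)      (zero-nilpotent _ _)    ()
  position-injective (nonzero-nilpotent _ _) (zero-regular _ _ _)    ()
  position-injective (nonzero-nilpotent _ _) (zero-nilpotent _ _)    ()

  position-comparable : ∀ {x y x′ y′} (k : Kind x y) (k′ : Kind x′ y′) → ¬ (x , y) ≈ (x′ , y′) →
    (¬ (x , y) * (x′ , y′) ≈ 0#) ⇔
    Comparable _≤²_ (position k (F₁.index x) (F₂.index y)) (position k′ (F₁.index x′) (F₂.index y′))
  position-comparable {y = y} {y′ = y′} (zero-regular _ _ ¬zd) (zero-regular _ y′≉0 _) _ =
    both (regular*nonzero ¬zd y′≉0 ∘ proj₂) (comparable-fst (suc (F₂.index y)) (suc (F₂.index y′)) 0)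
  position-comparable {y = y} (zero-regular _ _ ¬zd) (zero-nilpotent _ (_ , y′≉0)) _ =
    both (regular*nonzero ¬zd y′≉0 ∘ proj₂) (inj₁ (s≤s (<⇒≤ (F₂.index< y)) , z≤n))
  position-comparable (zero-regular x≈0 _ _) (nonzero-zero _ y′≈0) _ =
    neither (λ meets → meets (x≈0⇒x*y≈0 R₁ _ x≈0 , y≈0⇒x*y≈0 R₂ _ y′≈0))
            (λ { (inj₁ (() , _)) ; (inj₂ (_ , ())) })
  position-comparable {y = y} (zero-regular _ _ ¬zd) (nonzero-nilpotent _ (_ , y′≉0)) _ =
    both (regular*nonzero ¬zd y′≉0 ∘ proj₂) (inj₁ (F₂.index< y , z≤n))
  position-comparable {y′ = y′} (zero-nilpotent _ (_ , y≉0)) (zero-regular _ _ ¬zd′) _ =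
    both (nonzero*regular y≉0 ¬zd′ ∘ proj₂) (inj₂ (s≤s (<⇒≤ (F₂.index< y′)) , z≤n))
  position-comparable (zero-nilpotent x≈0 vy) (zero-nilpotent x′≈0 vy′) distinct =
    contradiction (A.trans x≈0 (A.sym x′≈0) , nilpotent-unique vy vy′) distinct
  position-comparable (zero-nilpotent x≈0 _) (nonzero-zero _ y′≈0) _ =
    neither (λ meets → meets (x≈0⇒x*y≈0 R₁ _ x≈0 , y≈0⇒x*y≈0 R₂ _ y′≈0))
            (λ { (inj₁ (() , _)) ; (inj₂ (_ , ())) })
  position-comparable (zero-nilpotent x≈0 vy) (nonzero-nilpotent _ vy′) _ =
    neither (λ meets → meets (x≈0⇒x*y≈0 R₁ _ x≈0 , nilpotent*nilpotent vy vy′))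
            (λ { (inj₁ (1+N₂≤N₂ , _)) → 1+n≰n 1+N₂≤N₂ ; (inj₂ (_ , ())) })
  position-comparable (nonzero-zero _ y≈0) (zero-regular x′≈0 _ _) _ =
    neither (λ meets → meets (y≈0⇒x*y≈0 R₁ _ x′≈0 , x≈0⇒x*y≈0 R₂ _ y≈0))
            (λ { (inj₁ (_ , ())) ; (inj₂ (() , _)) })
  position-comparable (nonzero-zero _ y≈0) (zero-nilpotent x′≈0 _) _ =
    neither (λ meets → meets (y≈0⇒x*y≈0 R₁ _ x′≈0 , x≈0⇒x*y≈0 R₂ _ y≈0))
            (λ { (inj₁ (_ , ())) ; (inj₂ (() , _)) })
  position-comparable {x = x} {x′ = x′} (nonzero-zero x≉0 _) (nonzero-zero x′≉0 _) _ =
    both (nonzero*nonzero x≉0 x′≉0 ∘ proj₁) (comparable-snd (suc (F₁.index x)) (suc (F₁.index x′)) 0)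
  position-comparable {x = x} (nonzero-zero x≉0 _) (nonzero-nilpotent x′≉0 _) _ =
    both (nonzero*nonzero x≉0 x′≉0 ∘ proj₁) (inj₁ (z≤n , s≤s (≤-trans (<⇒≤ (F₁.index< x)) (m≤m+n N₁ _))))
  position-comparable {y′ = y′} (nonzero-nilpotent _ (_ , y≉0)) (zero-regular _ _ ¬zd′) _ =
    both (nonzero*regular y≉0 ¬zd′ ∘ proj₂) (inj₂ (F₂.index< y′ , z≤n))
  position-comparable (nonzero-nilpotent _ vy) (zero-nilpotent x′≈0 vy′) _ =
    neither (λ meets → meets (y≈0⇒x*y≈0 R₁ _ x′≈0 , nilpotent*nilpotent vy vy′))
            (λ { (inj₁ (_ , ())) ; (inj₂ (1+N₂≤N₂ , _)) → 1+n≰n 1+N₂≤N₂ })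
  position-comparable {x′ = x′} (nonzero-nilpotent x≉0 _) (nonzero-zero x′≉0 _) _ =
    both (nonzero*nonzero x≉0 x′≉0 ∘ proj₁) (inj₂ (z≤n , s≤s (≤-trans (<⇒≤ (F₁.index< x′)) (m≤m+n N₁ _))))
  position-comparable {x = x} {x′ = x′} (nonzero-nilpotent x≉0 _) (nonzero-nilpotent x′≉0 _) _ =
    both (nonzero*nonzero x≉0 x′≉0 ∘ proj₁) (comparable-snd (suc (N₁ + F₁.index x)) (suc (N₁ + F₁.index x′)) N₂)

  label : Vertex R → ℕ × ℕ
  label v@((x , y) , _) = position (kind v) (F₁.index x) (F₂.index y)

  label-cong : ∀ {v w} → _≈ᵥ_ R v w → label v ≡ label w
  label-cong {v} {w} v≈w@(x≈x′ , y≈y′) = ≡.trans (position-resp v≈w (kind v) (kind w) _ _)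
    (cong₂ (position (kind w)) (F₁.index-cong x≈x′) (F₂.index-cong y≈y′))

  complementΓIsDivisorGraph : ComplementΓIsDivisorGraph R
  complementΓIsDivisorGraph = comparabilityLabelling⇒IsDivisorGraph label label-cong
    (λ {v} {w} → position-injective (kind v) (kind w))
    (λ {v} {w} v≉w → position-comparable (kind v) (kind w) v≉w ⇔-∘ AdjΓc⇔*≉0 R {v} {w} v≉w)

module _ {c ℓ} (R₁ R₂ : CommutativeRing c ℓ) where

  swapVertex : Vertex (commutativeRing R₁ R₂) → Vertex (commutativeRing R₂ R₁)
  swapVertex ((x , y) , ((s , t) , st≉0 , xs≈0 , yt≈0) , xy≉0) =
    (y , x) , ((t , s) , st≉0 ∘ swap , yt≈0 , xs≈0) , xy≉0 ∘ swap

  ComplementΓIsDivisorGraph-swap : ComplementΓIsDivisorGraph (commutativeRing R₂ R₁) →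
                                   ComplementΓIsDivisorGraph (commutativeRing R₁ R₂)
  ComplementΓIsDivisorGraph-swap = IsDivisorGraph-induced swapVertex swap swap
    (λ _ → mk⇔ (×.map (_∘ swap) (_∘ swap)) (×.map (_∘ swap) (_∘ swap)))

theorem2p2 : {c ℓ : Level} (R₁ R₂ : CommutativeRing c ℓ) →
    ¬ (CommutativeRing._≈_ R₁ (CommutativeRing.1# R₁) (CommutativeRing.0# R₁)) →
    ¬ (CommutativeRing._≈_ R₂ (CommutativeRing.1# R₂) (CommutativeRing.0# R₂)) →
    Finite R₁ → Finite R₂ →
    IsPrincipalIdealRing R₁ → IsPrincipalIdealRing R₂ →
    DiamΓZero R₁ → DiamΓZero R₂ →
    (ComplementΓIsDivisorGraph (commutativeRing R₁ R₂)
      ⇔ (IsIntegralDomain R₁ ⊎ IsIntegralDomain R₂))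
theorem2p2 R₁ R₂ 1≉0₁ 1≉0₂ fin₁ fin₂ _ _ diam₁ diam₂ = mk⇔ divisorGraph⇒domain domain⇒divisorGraph
  where
  divisorGraph⇒domain : ComplementΓIsDivisorGraph (commutativeRing R₁ R₂) →
                        IsIntegralDomain R₁ ⊎ IsIntegralDomain R₂
  divisorGraph⇒domain divisorGraph
    with FiniteRing.integralDomain⊎vertex R₁ fin₁ 1≉0₁ | FiniteRing.integralDomain⊎vertex R₂ fin₂ 1≉0₂
  ... | inj₁ domain₁ | _            = inj₁ domain₁
  ... | inj₂ _       | inj₁ domain₂ = inj₂ domain₂
  ... | inj₂ v₁      | inj₂ v₂      = contradiction divisorGraph
    (squareZero⇒¬ComplementΓIsDivisorGraph R₁ R₂ 1≉0₁ 1≉0₂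
      (diamΓZero⇒squareZeroElement R₁ diam₁ v₁) (diamΓZero⇒squareZeroElement R₂ diam₂ v₂))

  domain⇒divisorGraph : IsIntegralDomain R₁ ⊎ IsIntegralDomain R₂ →
                        ComplementΓIsDivisorGraph (commutativeRing R₁ R₂)
  domain⇒divisorGraph (inj₁ domain₁) =
    IntegralDomain×DiamΓZero.complementΓIsDivisorGraph R₁ R₂ fin₁ fin₂ domain₁ diam₂
  domain⇒divisorGraph (inj₂ domain₂) = ComplementΓIsDivisorGraph-swap R₁ R₂
    (IntegralDomain×DiamΓZero.complementΓIsDivisorGraph R₂ R₁ fin₂ fin₁ domain₂ diam₁)
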